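{- Let $b,c\in\mathbb{Z}$ and $d=b^2-4c$. For every positive integer $n$, $$nT_n(b,c)T_{n-1}(b,c)=b\sum_{j=0}^{n-1}(n-j)\binom{n+j}{2j}\binom{2j}{j}^2c^jd^{n-1-j}.$$
   Context: $T_n(b,c)$ is the coefficient of $x^n$ in $(x^2+bx+c)^n$, i.e. $T_n(b,c)=\sum_{k=0}^{\lfloor n/2\rfloor}\binom{n}{2k}\binom{2k}{k}b^{n-2k}c^k$. -}

module Defs where

open import Data.Nat using (ℕ; zero; suc; _∸_; _/_)
import Data.Nat as ℕ
open import Data.Nat.Combinatorics using (_C_)
open import Data.Integer using (ℤ; +_; _+_; _*_; _-_; _^_)

sumBelow : ℕ → (ℕ → ℤ) → ℤ
sumBelow zero    f = + 0
sumBelow (suc m) f = sumBelow m f + f m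

binomℤ : ℕ → ℕ → ℤ
binomℤ n k = + (n C k)

T : ℕ → ℤ → ℤ → ℤ
T n b c = sumBelow (suc (n / 2))
  (λ k → binomℤ n (2 ℕ.* k) * binomℤ (2 ℕ.* k) k * (b ^ (n ∸ 2 ℕ.* k)) * (c ^ k))

module Submission where

-- Put Q_n = Σ_{j≤n} C(n+j,2j) C(2j,j)² c^j d^(n-j), R_n = Σ_{j≤n} (2j+1) C(n+j,2j) C(2j,j)² c^j d^(n-j)
-- and let S_n be the sum on the right. The theorem is proved together with T_n² = Q_n by induction
-- on n (Invariant) from four identities:
--   (n+2) T_{n+2} = (2n+3) b T_{n+1} - (n+1) d T_n,       S_{n+1} = R_n + d S_n,
--   (2n+1) Q_n = R_n + 2 d S_n,       (n+2)² Q_{n+2} = (2n+3) b² R_{n+1} + (n+1)² d² Q_n,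
-- after which the induction step is ring arithmetic (module InductionStep).
-- Each identity is proved by comparing coefficients of the monomials b^(m-2k) c^k resp. c^j d^(m-j).
-- The coefficient identities follow from the shift relations of binomial coefficients (absorption,
-- lowerShift, upperShift), taken in ℤ so that they hold for all indices: every coefficient involved
-- becomes a polynomial multiple of one base coefficient, and what remains is a polynomial identity.

open import Defs
open import Data.Nat using (ℕ; zero; suc; _∸_; _<_; _≤_; z≤n; s≤s)
import Data.Nat as ℕ
import Data.Nat.Properties as ℕP
open import Data.Nat.Combinatorics using (_C_; nCk+nC[k+1]≡[n+1]C[k+1]; k>n⇒nCk≡0; nC1≡n)
open import Data.Integer using (ℤ; +_; _+_; _*_; _-_; _^_; 0ℤ; 1ℤ; NonZero)
open import Data.Integer.Properties
  using (pos-+; pos-*; ≤-⊖; m-n≡m⊖n; +-identityˡ; +-identityʳ; +-assoc; +-inverseʳ; *-zeroʳ;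
         *-identityˡ; *-identityʳ; *-assoc; *-distribˡ-+; *-distribʳ-+; *-cancelˡ-≡)
open import Data.Integer.Tactic.RingSolver using (solve-∀; solve)
open import Data.List using (_∷_; [])
open import Data.Sum using (inj₁; inj₂)
open import Data.Product using (_×_; _,_; proj₂)
open import Data.Nat.DivMod using (_/_; m*n/n≡m; /-monoˡ-≤; m/n≤m)
open import Relation.Nullary using (yes; no; contradiction)
open import Relation.Binary.PropositionalEquality
open ≡-Reasoning

pascal : ∀ n k → binomℤ n k + binomℤ n (suc k) ≡ binomℤ (suc n) (suc k)
pascal n k = trans (sym (pos-+ (n C k) (n C suc k))) (cong +_ (nCk+nC[k+1]≡[n+1]C[k+1] n k))

binom-vanish : ∀ {n k} → n < k → binomℤ n k ≡ 0ℤ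
binom-vanish n<k = cong +_ (k>n⇒nCk≡0 n<k)

absorption : ∀ n k → + suc k * binomℤ (suc n) (suc k) ≡ + suc n * binomℤ n k
absorption zero    zero    = refl
absorption zero    (suc k) = *-zeroʳ (+ suc (suc k))
absorption (suc n) zero    = begin
  1ℤ * binomℤ (suc (suc n)) 1 ≡⟨ *-identityˡ _ ⟩
  + (suc (suc n) C 1)         ≡⟨ cong +_ (nC1≡n (suc (suc n))) ⟩
  + suc (suc n)               ≡⟨ *-identityʳ _ ⟨
  + suc (suc n) * 1ℤ          ∎
absorption (suc n) (suc k) = begin
  + suc (suc k) * C₂₂
    ≡⟨ cong (+ suc (suc k) *_) (pascal (suc n) (suc k)) ⟨
  + suc (suc k) * (C₁₁ + C₁₂)
    ≡⟨ split (+ k) C₁₁ C₁₂ ⟩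
  + suc k * C₁₁ + C₁₁ + + suc (suc k) * C₁₂
    ≡⟨ cong₂ (λ x y → x + C₁₁ + y) (absorption n k) (absorption n (suc k)) ⟩
  + suc n * binomℤ n k + C₁₁ + + suc n * binomℤ n (suc k)
    ≡⟨ regroup (+ suc n) (binomℤ n k) C₁₁ (binomℤ n (suc k)) ⟩
  + suc n * (binomℤ n k + binomℤ n (suc k)) + C₁₁
    ≡⟨ cong (λ x → + suc n * x + C₁₁) (pascal n k) ⟩
  + suc n * C₁₁ + C₁₁
    ≡⟨ collect (+ n) C₁₁ ⟩
  + suc (suc n) * C₁₁ ∎
  where
  C₂₂ C₁₁ C₁₂ : ℤ
  C₂₂ = binomℤ (suc (suc n)) (suc (suc k))
  C₁₁ = binomℤ (suc n) (suc k)
  C₁₂ = binomℤ (suc n) (suc (suc k))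
  split : ∀ κ x y → (1ℤ + (1ℤ + κ)) * (x + y) ≡ (1ℤ + κ) * x + x + (1ℤ + (1ℤ + κ)) * y
  split = solve-∀
  regroup : ∀ ν x y z → ν * x + y + ν * z ≡ ν * (x + z) + y
  regroup = solve-∀
  collect : ∀ ν x → (1ℤ + ν) * x + x ≡ (1ℤ + (1ℤ + ν)) * x
  collect = solve-∀

lowerShift : ∀ n k → + suc k * binomℤ n (suc k) ≡ (+ n - + k) * binomℤ n k
lowerShift n k = begin
  + suc k * binomℤ n (suc k)
    ≡⟨ rearrange (+ suc k) (binomℤ n k) (binomℤ n (suc k)) ⟩
  + suc k * (binomℤ n k + binomℤ n (suc k)) - + suc k * binomℤ n k
    ≡⟨ cong (λ x → + suc k * x - + suc k * binomℤ n k) (pascal n k) ⟩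
  + suc k * binomℤ (suc n) (suc k) - + suc k * binomℤ n k
    ≡⟨ cong (_- + suc k * binomℤ n k) (absorption n k) ⟩
  + suc n * binomℤ n k - + suc k * binomℤ n k
    ≡⟨ difference (+ n) (+ k) (binomℤ n k) ⟩
  (+ n - + k) * binomℤ n k ∎
  where
  rearrange : ∀ κ x y → κ * y ≡ κ * (x + y) - κ * x
  rearrange = solve-∀
  difference : ∀ ν κ x → (1ℤ + ν) * x - (1ℤ + κ) * x ≡ (ν - κ) * x
  difference = solve-∀

upperShift : ∀ n k → (+ suc n - + k) * binomℤ (suc n) k ≡ + suc n * binomℤ n k
upperShift n k = trans (sym (lowerShift (suc n) k)) (absorption n k)

composeRatios : ∀ x y p q C₀ C₁ C₂ →
  x * C₂ ≡ p * C₁ → y * C₁ ≡ q * C₀ → x * y * C₂ ≡ p * q * C₀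
composeRatios x y p q C₀ C₁ C₂ h₂ h₁ = begin
  x * y * C₂   ≡⟨ solve (x ∷ y ∷ C₂ ∷ []) ⟩
  y * (x * C₂) ≡⟨ cong (y *_) h₂ ⟩
  y * (p * C₁) ≡⟨ solve (y ∷ p ∷ C₁ ∷ []) ⟩
  p * (y * C₁) ≡⟨ cong (p *_) h₁ ⟩
  p * (q * C₀) ≡⟨ solve (p ∷ q ∷ C₀ ∷ []) ⟩
  p * q * C₀   ∎

diagShift : ∀ N t → + suc (suc t) * + suc t * binomℤ (suc (suc N)) (suc (suc t))
                    ≡ + suc (suc N) * + suc N * binomℤ N t
diagShift N t = composeRatios (+ suc (suc t)) (+ suc t) (+ suc (suc N)) (+ suc N)
  (binomℤ N t) (binomℤ (suc N) (suc t)) (binomℤ (suc (suc N)) (suc (suc t)))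
  (absorption (suc N) (suc t)) (absorption N t)

midShift : ∀ N t → + suc (suc t) * + suc t * binomℤ (suc N) (suc (suc t))
                   ≡ + suc N * (+ N - + t) * binomℤ N t
midShift N t = composeRatios (+ suc (suc t)) (+ suc t) (+ suc N) (+ N - + t)
  (binomℤ N t) (binomℤ N (suc t)) (binomℤ (suc N) (suc (suc t)))
  (absorption N (suc t)) (lowerShift N t)

lowShift : ∀ N t → + suc (suc t) * + suc t * binomℤ N (suc (suc t))
                   ≡ (+ N - + suc t) * (+ N - + t) * binomℤ N t
lowShift N t = composeRatios (+ suc (suc t)) (+ suc t) (+ N - + suc t) (+ N - + t)
  (binomℤ N t) (binomℤ N (suc t)) (binomℤ N (suc (suc t)))
  (lowerShift N (suc t)) (lowerShift N t)

-- (k+1) C(2k+1,k) = (2k+1) C(2k,k), since C(2k+1,k) = C(2k+1,k+1).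
nearCentral : ∀ k → + suc k * binomℤ (suc (2 ℕ.* k)) k ≡ + suc (2 ℕ.* k) * binomℤ (2 ℕ.* k) k
nearCentral k = begin
  + suc k * binomℤ (suc t) k                 ≡⟨ cong (_* binomℤ (suc t) k) excess ⟨
  (+ suc t - + k) * binomℤ (suc t) k         ≡⟨ lowerShift (suc t) k ⟨
  + suc k * binomℤ (suc t) (suc k)           ≡⟨ absorption t k ⟩
  + suc t * binomℤ t k                       ∎
  where
  t : ℕ
  t = 2 ℕ.* k
  excess : + suc t - + k ≡ + suc k
  excess = trans (cong (λ τ → 1ℤ + τ - + k) (pos-* 2 k)) (cancel (+ k))
    where
    cancel : ∀ κ → 1ℤ + + 2 * κ - κ ≡ 1ℤ + κ
    cancel = solve-∀

centralShift : ∀ k → + suc k * + suc k * binomℤ (suc (suc (2 ℕ.* k))) (suc k)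
                     ≡ + suc (suc (2 ℕ.* k)) * + suc (2 ℕ.* k) * binomℤ (2 ℕ.* k) k
centralShift k = composeRatios (+ suc k) (+ suc k) (+ suc (suc t)) (+ suc t) (binomℤ t k) (binomℤ (suc t) k)
    (binomℤ (suc (suc t)) (suc k)) (absorption (suc t) k) (nearCentral k)
  where
  t : ℕ
  t = 2 ℕ.* k

-- Coefficients of T_n in the monomials b^(n-2k) c^k: C(n,2k) C(2k,k).
tc : ℕ → ℕ → ℤ
tc n k = binomℤ n (2 ℕ.* k) * binomℤ (2 ℕ.* k) k

-- Coefficients of T_n² in the monomials c^j d^(n-j): C(n+j,2j) C(2j,j)².
qc : ℕ → ℕ → ℤ
qc n j = binomℤ (n ℕ.+ j) (2 ℕ.* j) * binomℤ (2 ℕ.* j) j ^ 2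

odd : ℕ → ℤ
odd n = + 2 * + n + 1ℤ

rc : ℕ → ℕ → ℤ
rc n j = odd j * qc n j

-- Coefficients of d S_n = Σ (n-j) C(n+j,2j) C(2j,j)² c^j d^(n-j).
sc : ℕ → ℕ → ℤ
sc n j = (+ n - + j) * qc n j

-- A coefficient sequence moved up by one place (multiplication of the series by a variable).
shift : (ℕ → ℤ) → ℕ → ℤ
shift g zero    = 0ℤ
shift g (suc j) = g j

tc-vanish : ∀ n k → n < 2 ℕ.* k → tc n k ≡ 0ℤ
tc-vanish n k n<2k = cong (_* binomℤ (2 ℕ.* k) k) (binom-vanish n<2k)

qc-vanish : ∀ n j → n < j → qc n j ≡ 0ℤ
qc-vanish n j n<j = cong (_* binomℤ (2 ℕ.* j) j ^ 2) (binom-vanish n+j<2j)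
  where
  n+j<2j : n ℕ.+ j < 2 ℕ.* j
  n+j<2j = ℕP.<-≤-trans (ℕP.+-monoˡ-< j n<j) (ℕP.≤-reflexive (cong (j ℕ.+_) (sym (ℕP.+-identityʳ j))))

ratioProduct : ∀ P K f X₀ X₂ Y₀ Y₂ .{{_ : NonZero P}} →
  P * X₂ ≡ f * X₀ → K * Y₂ ≡ P * Y₀ → K * (X₂ * Y₂) ≡ f * (X₀ * Y₀)
ratioProduct P K f X₀ X₂ Y₀ Y₂ hX hY = *-cancelˡ-≡ P _ _ (begin
  P * (K * (X₂ * Y₂))    ≡⟨ solve (P ∷ K ∷ X₂ ∷ Y₂ ∷ []) ⟩
  (P * X₂) * (K * Y₂)    ≡⟨ cong₂ _*_ hX hY ⟩
  (f * X₀) * (P * Y₀)    ≡⟨ solve (f ∷ X₀ ∷ P ∷ Y₀ ∷ []) ⟩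
  P * (f * (X₀ * Y₀))    ∎)

tc-step : ∀ n' n k f →
  + suc (suc (2 ℕ.* k)) * + suc (2 ℕ.* k) * binomℤ n' (suc (suc (2 ℕ.* k))) ≡ f * binomℤ n (2 ℕ.* k) →
  + suc k * + suc k * tc n' (suc k) ≡ f * tc n k
tc-step n' n k f h =
  subst (λ u → + suc k * + suc k * (binomℤ n' u * binomℤ u (suc k)) ≡ f * tc n k) (sym (ℕP.*-suc 2 k))
    (ratioProduct (+ suc (suc t) * + suc t) (+ suc k * + suc k) f (binomℤ n t)
       (binomℤ n' (suc (suc t))) (binomℤ t k) (binomℤ (suc (suc t)) (suc k)) h (centralShift k))
  where
  t : ℕ
  t = 2 ℕ.* k

tc-shift₂ : ∀ n k → + suc k * + suc k * tc (suc (suc n)) (suc k) ≡ + suc (suc n) * + suc n * tc n k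
tc-shift₂ n k = tc-step (suc (suc n)) n k (+ suc (suc n) * + suc n) (diagShift n (2 ℕ.* k))

tc-shift₁ : ∀ n k → + suc k * + suc k * tc (suc n) (suc k) ≡ + suc n * (+ n - + (2 ℕ.* k)) * tc n k
tc-shift₁ n k = tc-step (suc n) n k (+ suc n * (+ n - + (2 ℕ.* k))) (midShift n (2 ℕ.* k))

tc-shift₀ : ∀ n k → + suc k * + suc k * tc n (suc k)
                    ≡ (+ n - + suc (2 ℕ.* k)) * (+ n - + (2 ℕ.* k)) * tc n k
tc-shift₀ n k = tc-step n n k ((+ n - + suc (2 ℕ.* k)) * (+ n - + (2 ℕ.* k))) (lowShift n (2 ℕ.* k))

-- The same for qc; the cancelled factor (2j+2)(2j+1) survives once because of the square.
qc-step : ∀ m n j f →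
  + suc (suc (2 ℕ.* j)) * + suc (2 ℕ.* j) * binomℤ (suc (m ℕ.+ j)) (suc (suc (2 ℕ.* j)))
    ≡ f * binomℤ (n ℕ.+ j) (2 ℕ.* j) →
  + suc j * + suc j * (+ suc j * + suc j) * qc m (suc j)
    ≡ f * (+ suc (suc (2 ℕ.* j)) * + suc (2 ℕ.* j)) * qc n j
qc-step m n j f h =
  subst₂ (λ u v → K * K * (binomℤ u v * binomℤ v (suc j) ^ 2) ≡ f * P * qc n j)
    (sym (ℕP.+-suc m j)) (sym (ℕP.*-suc 2 j))
    (trans (ratioProduct P (K * K) f (binomℤ (n ℕ.+ j) t) (binomℤ (suc (m ℕ.+ j)) (suc (suc t)))
              (P * binomℤ t j ^ 2) (binomℤ (suc (suc t)) (suc j) ^ 2) h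
              (square K P (binomℤ (suc (suc t)) (suc j)) (binomℤ t j) (centralShift j)))
           (reassociate f P (binomℤ (n ℕ.+ j) t) (binomℤ t j ^ 2)))
  where
  t : ℕ
  t = 2 ℕ.* j
  K P : ℤ
  K = + suc j * + suc j
  P = + suc (suc t) * + suc t
  -- Squaring a ratio relation; Y ^ 2 unfolds to Y * (Y * 1ℤ).
  square : ∀ x y Y Y₀ → x * Y ≡ y * Y₀ → x * x * (Y * (Y * 1ℤ)) ≡ y * (y * (Y₀ * (Y₀ * 1ℤ)))
  square x y Y Y₀ h = begin
    x * x * (Y * (Y * 1ℤ))       ≡⟨ solve (x ∷ Y ∷ []) ⟩
    (x * Y) * (x * Y)             ≡⟨ cong (λ z → z * z) h ⟩
    (y * Y₀) * (y * Y₀)           ≡⟨ solve (y ∷ Y₀ ∷ []) ⟩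
    y * (y * (Y₀ * (Y₀ * 1ℤ)))   ∎
  reassociate : ∀ f p X Y₂ → f * (X * (p * Y₂)) ≡ f * p * (X * Y₂)
  reassociate = solve-∀

qc-shift₂ : ∀ n j → + suc j * + suc j * (+ suc j * + suc j) * qc (suc (suc n)) (suc j)
  ≡ + suc (suc (suc (n ℕ.+ j))) * + suc (suc (n ℕ.+ j))
    * (+ suc (suc (2 ℕ.* j)) * + suc (2 ℕ.* j)) * qc (suc n) j
qc-shift₂ n j = qc-step (suc (suc n)) (suc n) j (+ suc (suc (suc (n ℕ.+ j))) * + suc (suc (n ℕ.+ j)))
  (diagShift (suc (n ℕ.+ j)) (2 ℕ.* j))

qc-shift₁ : ∀ n j → + suc j * + suc j * (+ suc j * + suc j) * qc (suc n) (suc j)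
  ≡ + suc (suc (n ℕ.+ j)) * (+ suc (n ℕ.+ j) - + (2 ℕ.* j))
    * (+ suc (suc (2 ℕ.* j)) * + suc (2 ℕ.* j)) * qc (suc n) j
qc-shift₁ n j = qc-step (suc n) (suc n) j (+ suc (suc (n ℕ.+ j)) * (+ suc (n ℕ.+ j) - + (2 ℕ.* j)))
  (midShift (suc (n ℕ.+ j)) (2 ℕ.* j))

qc-shift₀ : ∀ n j → + suc j * + suc j * (+ suc j * + suc j) * qc n (suc j)
  ≡ (+ suc (n ℕ.+ j) - + suc (2 ℕ.* j)) * (+ suc (n ℕ.+ j) - + (2 ℕ.* j))
    * (+ suc (suc (2 ℕ.* j)) * + suc (2 ℕ.* j)) * qc (suc n) j
qc-shift₀ n j = qc-step n (suc n) j ((+ suc (n ℕ.+ j) - + suc (2 ℕ.* j)) * (+ suc (n ℕ.+ j) - + (2 ℕ.* j)))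
  (lowShift (suc (n ℕ.+ j)) (2 ℕ.* j))

-- For k+1 all terms are rational multiples of tc n k; after clearing the factor (k+1)² the
-- claim is a polynomial identity in n and k.
tc-recurrence : ∀ n k → + suc (suc n) * tc (suc (suc n)) k + + suc n * tc n k
                        ≡ odd (suc n) * tc (suc n) k + + 4 * + suc n * shift (tc n) k
tc-recurrence n zero    = base (+ n)
  where
  base : ∀ ν → (1ℤ + (1ℤ + ν)) * 1ℤ + (1ℤ + ν) * 1ℤ ≡ (+ 2 * (1ℤ + ν) + 1ℤ) * 1ℤ + + 4 * (1ℤ + ν) * 0ℤ
  base = solve-∀
tc-recurrence n (suc k) = *-cancelˡ-≡ K _ _ (begin
  K * (+ suc (suc n) * tc (suc (suc n)) (suc k) + + suc n * tc n (suc k))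
    ≡⟨ distribute K (+ suc (suc n)) (+ suc n) (tc (suc (suc n)) (suc k)) (tc n (suc k)) ⟩
  + suc (suc n) * (K * tc (suc (suc n)) (suc k)) + + suc n * (K * tc n (suc k))
    ≡⟨ cong₂ (λ x y → + suc (suc n) * x + + suc n * y) (tc-shift₂ n k) (tc-shift₀ n k) ⟩
  + suc (suc n) * (+ suc (suc n) * + suc n * E) + + suc n * ((+ n - + suc t) * (+ n - + t) * E)
    ≡⟨ polynomial (+ n) (+ k) (+ t) E (pos-* 2 k) ⟩
  odd (suc n) * (+ suc n * (+ n - + t) * E) + + 4 * + suc n * (K * E)
    ≡⟨ cong (λ x → odd (suc n) * x + + 4 * + suc n * (K * E)) (tc-shift₁ n k) ⟨
  odd (suc n) * (K * tc (suc n) (suc k)) + + 4 * + suc n * (K * E)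
    ≡⟨ distribute K (odd (suc n)) (+ 4 * + suc n) (tc (suc n) (suc k)) E ⟨
  K * (odd (suc n) * tc (suc n) (suc k) + + 4 * + suc n * E) ∎)
  where
  t : ℕ
  t = 2 ℕ.* k
  K E : ℤ
  K = + suc k * + suc k
  E = tc n k
  distribute : ∀ K a b x y → K * (a * x + b * y) ≡ a * (K * x) + b * (K * y)
  distribute = solve-∀
  polynomial : ∀ ν κ τ E → τ ≡ + 2 * κ →
    (1ℤ + (1ℤ + ν)) * ((1ℤ + (1ℤ + ν)) * (1ℤ + ν) * E) + (1ℤ + ν) * ((ν - (1ℤ + τ)) * (ν - τ) * E)
    ≡ (+ 2 * (1ℤ + ν) + 1ℤ) * ((1ℤ + ν) * (ν - τ) * E) + + 4 * (1ℤ + ν) * ((1ℤ + κ) * (1ℤ + κ) * E)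
  polynomial ν κ _ E refl = solve (ν ∷ κ ∷ E ∷ [])

-- Termwise form of the recurrence
--   (n+2)² Q_{n+2} = (2n+3) (d R_{n+1} + 4 c R_{n+1}) + (n+1)² d² Q_n,
-- proved like tc-recurrence, with the base qc (n+1) j and the factor (j+1)⁴.
qc-recurrence : ∀ n j → + suc (suc n) * + suc (suc n) * qc (suc (suc n)) j
  ≡ odd (suc n) * rc (suc n) j + + 4 * odd (suc n) * shift (rc (suc n)) j + + suc n * + suc n * qc n j
qc-recurrence n zero    = base (+ n)
  where
  base : ∀ ν → (1ℤ + (1ℤ + ν)) * (1ℤ + (1ℤ + ν)) * 1ℤ
               ≡ (+ 2 * (1ℤ + ν) + 1ℤ) * (1ℤ * 1ℤ) + + 4 * (+ 2 * (1ℤ + ν) + 1ℤ) * 0ℤ + (1ℤ + ν) * (1ℤ + ν) * 1ℤ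
  base = solve-∀
qc-recurrence n (suc j) = *-cancelˡ-≡ (K * K) _ _ (begin
  K * K * (+ suc (suc n) * + suc (suc n) * qc (suc (suc n)) (suc j))
    ≡⟨ rotate (K * K) (+ suc (suc n) * + suc (suc n)) (qc (suc (suc n)) (suc j)) ⟩
  + suc (suc n) * + suc (suc n) * (K * K * qc (suc (suc n)) (suc j))
    ≡⟨ cong (+ suc (suc n) * + suc (suc n) *_) (qc-shift₂ n j) ⟩
  + suc (suc n) * + suc (suc n) * (+ suc (suc N) * + suc N * P * A)
    ≡⟨ polynomial (+ n) (+ j) (+ t) A (pos-* 2 j) ⟩
  odd (suc n) * odd (suc j) * (+ suc N * (+ N - + t) * P * A) + + 4 * odd (suc n) * odd j * (K * K * A)
    + + suc n * + suc n * ((+ N - + suc t) * (+ N - + t) * P * A)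
    ≡⟨ cong₂ (λ x y → odd (suc n) * odd (suc j) * x + + 4 * odd (suc n) * odd j * (K * K * A)
                        + + suc n * + suc n * y) (qc-shift₁ n j) (qc-shift₀ n j) ⟨
  odd (suc n) * odd (suc j) * (K * K * qc (suc n) (suc j)) + + 4 * odd (suc n) * odd j * (K * K * A)
    + + suc n * + suc n * (K * K * qc n (suc j))
    ≡⟨ collect (K * K) (odd (suc n)) (odd (suc j)) (odd j) (+ suc n * + suc n)
         (qc (suc n) (suc j)) A (qc n (suc j)) ⟩
  K * K * (odd (suc n) * (odd (suc j) * qc (suc n) (suc j)) + + 4 * odd (suc n) * (odd j * A)
           + + suc n * + suc n * qc n (suc j)) ∎)
  where
  N t : ℕ
  N = suc (n ℕ.+ j)
  t = 2 ℕ.* j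
  K P A : ℤ
  K = + suc j * + suc j
  P = + suc (suc t) * + suc t
  A = qc (suc n) j
  rotate : ∀ L a x → L * (a * x) ≡ a * (L * x)
  rotate = solve-∀
  collect : ∀ L a b₁ b₀ s x y z →
    a * b₁ * (L * x) + + 4 * a * b₀ * (L * y) + s * (L * z) ≡ L * (a * (b₁ * x) + + 4 * a * (b₀ * y) + s * z)
  collect = solve-∀
  polynomial : ∀ ν ι τ A → τ ≡ + 2 * ι →
    (1ℤ + (1ℤ + ν)) * (1ℤ + (1ℤ + ν))
      * ((1ℤ + (1ℤ + (1ℤ + (ν + ι)))) * (1ℤ + (1ℤ + (ν + ι))) * ((1ℤ + (1ℤ + τ)) * (1ℤ + τ)) * A)
    ≡ (+ 2 * (1ℤ + ν) + 1ℤ) * (+ 2 * (1ℤ + ι) + 1ℤ)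
        * ((1ℤ + (1ℤ + (ν + ι))) * (1ℤ + (ν + ι) - τ) * ((1ℤ + (1ℤ + τ)) * (1ℤ + τ)) * A)
      + + 4 * (+ 2 * (1ℤ + ν) + 1ℤ) * (+ 2 * ι + 1ℤ) * ((1ℤ + ι) * (1ℤ + ι) * ((1ℤ + ι) * (1ℤ + ι)) * A)
      + (1ℤ + ν) * (1ℤ + ν)
        * ((1ℤ + (ν + ι) - (1ℤ + τ)) * (1ℤ + (ν + ι) - τ) * ((1ℤ + (1ℤ + τ)) * (1ℤ + τ)) * A)
  polynomial ν ι _ A refl = solve (ν ∷ ι ∷ A ∷ [])

-- Raising n in qc: (n+1-j) qc (n+1) j = (n+j+1) qc n j = (2j+1) qc n j + (n-j) qc n j.
qc-upper : ∀ n j → sc (suc n) j ≡ rc n j + sc n j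
qc-upper n j = begin
  (+ suc n - + j) * (binomℤ (suc (n ℕ.+ j)) t * Y)
    ≡⟨ reshape (+ n) (+ j) (+ t) (binomℤ (suc (n ℕ.+ j)) t) Y (pos-* 2 j) ⟩
  (+ suc (n ℕ.+ j) - + t) * binomℤ (suc (n ℕ.+ j)) t * Y
    ≡⟨ cong (_* Y) (upperShift (n ℕ.+ j) t) ⟩
  + suc (n ℕ.+ j) * binomℤ (n ℕ.+ j) t * Y
    ≡⟨ split (+ n) (+ j) (binomℤ (n ℕ.+ j) t) Y ⟩
  odd j * qc n j + (+ n - + j) * qc n j ∎
  where
  t : ℕ
  t = 2 ℕ.* j
  Y : ℤ
  Y = binomℤ t j ^ 2
  reshape : ∀ ν ι τ X Y → τ ≡ + 2 * ι → (1ℤ + ν - ι) * (X * Y) ≡ (1ℤ + (ν + ι) - τ) * X * Y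
  reshape ν ι _ X Y refl = solve (ν ∷ ι ∷ X ∷ Y ∷ [])
  split : ∀ ν ι X Y → (1ℤ + (ν + ι)) * X * Y ≡ (+ 2 * ι + 1ℤ) * (X * Y) + (ν - ι) * (X * Y)
  split = solve-∀

sum-cong : ∀ m {f g : ℕ → ℤ} → (∀ j → j < m → f j ≡ g j) → sumBelow m f ≡ sumBelow m g
sum-cong zero    _  = refl
sum-cong (suc m) eq = cong₂ _+_ (sum-cong m (λ j j<m → eq j (ℕP.m<n⇒m<1+n j<m))) (eq m (ℕP.n<1+n m))

sum-+ : ∀ m (f g : ℕ → ℤ) → sumBelow m (λ j → f j + g j) ≡ sumBelow m f + sumBelow m g
sum-+ zero    f g = refl
sum-+ (suc m) f g =
  trans (cong (_+ (f m + g m)) (sum-+ m f g)) (interchange (sumBelow m f) (sumBelow m g) (f m) (g m))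
  where
  interchange : ∀ a b x y → (a + b) + (x + y) ≡ (a + x) + (b + y)
  interchange = solve-∀

sum-scale : ∀ m x (f : ℕ → ℤ) → x * sumBelow m f ≡ sumBelow m (λ j → x * f j)
sum-scale zero    x f = *-zeroʳ x
sum-scale (suc m) x f = trans (*-distribˡ-+ x (sumBelow m f) (f m)) (cong (_+ x * f m) (sum-scale m x f))

sum-first : ∀ m (f : ℕ → ℤ) → sumBelow (suc m) f ≡ f 0 + sumBelow m (λ j → f (suc j))
sum-first zero    f = trans (+-identityˡ (f 0)) (sym (+-identityʳ (f 0)))
sum-first (suc m) f = trans (cong (_+ f (suc m)) (sum-first m f)) (+-assoc (f 0) _ (f (suc m)))

expand : ℕ → (ℕ → ℤ) → (ℕ → ℤ) → ℤ
expand m w g = sumBelow (suc m) (λ j → g j * w j)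

expand-cong : ∀ m w {f g : ℕ → ℤ} → (∀ j → f j ≡ g j) → expand m w f ≡ expand m w g
expand-cong m w eq = sum-cong (suc m) (λ j _ → cong (_* w j) (eq j))

expand-+ : ∀ m w (f g : ℕ → ℤ) → expand m w (λ j → f j + g j) ≡ expand m w f + expand m w g
expand-+ m w f g =
  trans (sum-cong (suc m) (λ j _ → *-distribʳ-+ (w j) (f j) (g j)))
        (sum-+ (suc m) (λ j → f j * w j) (λ j → g j * w j))

expand-scale : ∀ m w x (f : ℕ → ℤ) → expand m w (λ j → x * f j) ≡ x * expand m w f
expand-scale m w x f =
  trans (sum-cong (suc m) (λ j _ → *-assoc x (f j) (w j))) (sym (sum-scale (suc m) x (λ j → f j * w j)))

expand-lin : ∀ m w x y (f g : ℕ → ℤ) →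
  expand m w (λ j → x * f j + y * g j) ≡ x * expand m w f + y * expand m w g
expand-lin m w x y f g =
  trans (expand-+ m w (λ j → x * f j) (λ j → y * g j)) (cong₂ _+_ (expand-scale m w x f) (expand-scale m w y g))

expand-rescale : ∀ m x w w' (g : ℕ → ℤ) → (∀ j → j ≤ m → x * (g j * w j) ≡ g j * w' j) →
  x * expand m w g ≡ expand m w' g
expand-rescale m x w w' g eq =
  trans (sum-scale (suc m) x (λ j → g j * w j)) (sum-cong (suc m) (λ j j<1+m → eq j (ℕP.≤-pred j<1+m)))

rescale-vanishing : ∀ x {c w w'} → c ≡ 0ℤ → x * (c * w) ≡ c * w'
rescale-vanishing x refl = *-zeroʳ x

expand-trim : ∀ m w (g : ℕ → ℤ) → g (suc m) ≡ 0ℤ → expand (suc m) w g ≡ expand m w g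
expand-trim m w g g0 = trans (cong (λ x → expand m w g + x * w (suc m)) g0) (+-identityʳ _)

expand-extend : ∀ {m m'} w (g : ℕ → ℤ) → m ≤ m' → (∀ j → m < j → g j ≡ 0ℤ) → expand m' w g ≡ expand m w g
expand-extend {m} {zero}   w g z≤n     _    = refl
expand-extend {m} {suc m'} w g m≤1+m' vanish with ℕP.m≤n⇒m<n∨m≡n m≤1+m'
... | inj₂ refl       = refl
... | inj₁ (s≤s m≤m') =
  trans (expand-trim m' w g (vanish (suc m') (s≤s m≤m'))) (expand-extend w g m≤m' vanish)

expand-shift : ∀ m w (g : ℕ → ℤ) → expand (suc m) w (shift g) ≡ expand m (λ j → w (suc j)) g
expand-shift m w g = trans (sum-first (suc m) (λ j → shift g j * w j)) (+-identityˡ _)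

∸-cast : ∀ {m j} → j ≤ m → + (m ∸ j) ≡ + m - + j
∸-cast {m} {j} j≤m = trans (sym (≤-⊖ j≤m)) (sym (m-n≡m⊖n m j))

n<2[1+n] : ∀ n → n < 2 ℕ.* suc n
n<2[1+n] n = ℕP.≤-trans (ℕP.n<1+n n) (ℕP.m≤m+n (suc n) _)

beyond-half : ∀ n k → n / 2 < k → n < 2 ℕ.* k
beyond-half n k n/2<k with n ℕP.<? 2 ℕ.* k
... | yes n<2k = n<2k
... | no  n≮2k = contradiction k≤n/2 (ℕP.<⇒≱ n/2<k)
  where
  k≤n/2 : k ≤ n / 2
  k≤n/2 = ℕP.≤-trans (ℕP.≤-reflexive (sym (m*n/n≡m k 2)))
            (/-monoˡ-≤ 2 (subst (ℕ._≤ n) (ℕP.*-comm 2 k) (ℕP.≮⇒≥ n≮2k)))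

-- Read T₀ T₁ T₂ as T_n, T_{n+1}, T_{n+2} and
-- k₁ k₂ k₃ as n+1, n+2, 2n+3: from the recurrence for T, the invariant at n and the
-- identities among Q, R, S, both halves of the invariant follow at n+1.
module InductionStep (b d k₁ k₂ k₃ T₀ T₁ T₂ Q₀ Q₁ Q₂ R₁ S₁ S₂ : ℤ)
  (recurrence : k₂ * T₂ ≡ k₃ * b * T₁ - k₁ * d * T₀)
  (square₀ : T₀ * T₀ ≡ Q₀) (square₁ : T₁ * T₁ ≡ Q₁) (product₁ : k₁ * T₁ * T₀ ≡ b * S₁)
  (Q-via-R : k₃ * Q₁ ≡ R₁ + + 2 * (d * S₁)) (S-via-R : S₂ ≡ R₁ + d * S₁)
  (Q-step : k₂ * k₂ * Q₂ ≡ k₃ * b * b * R₁ + k₁ * k₁ * d * d * Q₀) where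

  product₂ : k₂ * T₂ * T₁ ≡ b * S₂
  product₂ = begin
    k₂ * T₂ * T₁                                  ≡⟨ cong (_* T₁) recurrence ⟩
    (k₃ * b * T₁ - k₁ * d * T₀) * T₁             ≡⟨ solve (k₁ ∷ k₃ ∷ b ∷ d ∷ T₀ ∷ T₁ ∷ []) ⟩
    k₃ * b * (T₁ * T₁) - d * (k₁ * T₁ * T₀)      ≡⟨ cong₂ (λ x y → k₃ * b * x - d * y) square₁ product₁ ⟩
    k₃ * b * Q₁ - d * (b * S₁)                    ≡⟨ solve (k₃ ∷ b ∷ d ∷ Q₁ ∷ S₁ ∷ []) ⟩
    b * (k₃ * Q₁) - b * (d * S₁)                  ≡⟨ cong (λ x → b * x - b * (d * S₁)) Q-via-R ⟩
    b * (R₁ + + 2 * (d * S₁)) - b * (d * S₁)      ≡⟨ solve (b ∷ d ∷ R₁ ∷ S₁ ∷ []) ⟩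
    b * (R₁ + d * S₁)                             ≡⟨ cong (b *_) S-via-R ⟨
    b * S₂                                        ∎

  square₂ : k₂ * k₂ * (T₂ * T₂) ≡ k₂ * k₂ * Q₂
  square₂ = begin
    k₂ * k₂ * (T₂ * T₂)
      ≡⟨ solve (k₂ ∷ T₂ ∷ []) ⟩
    (k₂ * T₂) * (k₂ * T₂)
      ≡⟨ cong (λ x → x * x) recurrence ⟩
    (k₃ * b * T₁ - k₁ * d * T₀) * (k₃ * b * T₁ - k₁ * d * T₀)
      ≡⟨ solve (k₁ ∷ k₃ ∷ b ∷ d ∷ T₀ ∷ T₁ ∷ []) ⟩
    k₃ * k₃ * b * b * (T₁ * T₁) - + 2 * k₃ * b * d * (k₁ * T₁ * T₀) + k₁ * k₁ * d * d * (T₀ * T₀)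
      ≡⟨ cong₂ (λ x y → k₃ * k₃ * b * b * x - + 2 * k₃ * b * d * y + k₁ * k₁ * d * d * (T₀ * T₀))
               square₁ product₁ ⟩
    k₃ * k₃ * b * b * Q₁ - + 2 * k₃ * b * d * (b * S₁) + k₁ * k₁ * d * d * (T₀ * T₀)
      ≡⟨ cong (λ x → k₃ * k₃ * b * b * Q₁ - + 2 * k₃ * b * d * (b * S₁) + k₁ * k₁ * d * d * x) square₀ ⟩
    k₃ * k₃ * b * b * Q₁ - + 2 * k₃ * b * d * (b * S₁) + k₁ * k₁ * d * d * Q₀
      ≡⟨ solve (k₁ ∷ k₃ ∷ b ∷ d ∷ Q₀ ∷ Q₁ ∷ S₁ ∷ []) ⟩
    k₃ * b * b * (k₃ * Q₁ - + 2 * (d * S₁)) + k₁ * k₁ * d * d * Q₀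
      ≡⟨ cong (λ x → k₃ * b * b * (x - + 2 * (d * S₁)) + k₁ * k₁ * d * d * Q₀) Q-via-R ⟩
    k₃ * b * b * (R₁ + + 2 * (d * S₁) - + 2 * (d * S₁)) + k₁ * k₁ * d * d * Q₀
      ≡⟨ solve (k₁ ∷ k₃ ∷ b ∷ d ∷ Q₀ ∷ R₁ ∷ S₁ ∷ []) ⟩
    k₃ * b * b * R₁ + k₁ * k₁ * d * d * Q₀
      ≡⟨ Q-step ⟨
    k₂ * k₂ * Q₂ ∎

module _ (b c : ℤ) where

  d : ℤ
  d = b * b - + 4 * c

  bc-monomial : ℕ → ℕ → ℤ
  bc-monomial m k = b ^ (m ∸ 2 ℕ.* k) * c ^ k

  G : ℕ → (ℕ → ℤ) → ℤ
  G m = expand m (bc-monomial m)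

  cd-monomial : ℕ → ℕ → ℤ
  cd-monomial m j = c ^ j * d ^ (m ∸ j)

  H : ℕ → (ℕ → ℤ) → ℤ
  H m = expand m (cd-monomial m)

  private
    lift-left : ∀ x g u v → x * (g * (u * v)) ≡ g * (x * u * v)
    lift-left = solve-∀
    lift-right : ∀ x g u v → x * (g * (u * v)) ≡ g * (u * (x * v))
    lift-right = solve-∀

  G-mul-b : ∀ m g → (∀ k → m < 2 ℕ.* k → g k ≡ 0ℤ) → b * G m g ≡ G (suc m) g
  G-mul-b m g vanish =
    trans (expand-rescale m b (bc-monomial m) (bc-monomial (suc m)) g raise)
          (sym (expand-trim m (bc-monomial (suc m)) g (vanish (suc m) (n<2[1+n] m))))
    where
    raise : ∀ k → k ≤ m → b * (g k * bc-monomial m k) ≡ g k * bc-monomial (suc m) k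
    raise k _ with 2 ℕ.* k ℕP.≤? m
    ... | yes 2k≤m = trans (lift-left b (g k) (b ^ (m ∸ 2 ℕ.* k)) (c ^ k))
                           (cong (λ e → g k * (b ^ e * c ^ k)) (sym (ℕP.+-∸-assoc 1 2k≤m)))
    ... | no  2k≰m = rescale-vanishing b (vanish k (ℕP.≰⇒> 2k≰m))

  G-mul-c : ∀ m g → g (suc m) ≡ 0ℤ → c * G m g ≡ G (suc (suc m)) (shift g)
  G-mul-c m g top = begin
    c * G m g
      ≡⟨ expand-rescale m c (bc-monomial m) (λ k → bc-monomial (suc (suc m)) (suc k)) g raise ⟩
    expand m (λ k → bc-monomial (suc (suc m)) (suc k)) g
      ≡⟨ expand-shift m (bc-monomial (suc (suc m))) g ⟨
    expand (suc m) (bc-monomial (suc (suc m))) (shift g)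
      ≡⟨ expand-trim (suc m) (bc-monomial (suc (suc m))) (shift g) top ⟨
    G (suc (suc m)) (shift g) ∎
    where
    raise : ∀ k → k ≤ m → c * (g k * bc-monomial m k) ≡ g k * bc-monomial (suc (suc m)) (suc k)
    raise k _ = trans (lift-right c (g k) (b ^ (m ∸ 2 ℕ.* k)) (c ^ k))
                      (cong (λ e → g k * (b ^ (suc (suc m) ∸ e) * c ^ suc k)) (sym (ℕP.*-suc 2 k)))

  H-mul-d : ∀ m g → g (suc m) ≡ 0ℤ → d * H m g ≡ H (suc m) g
  H-mul-d m g top =
    trans (expand-rescale m d (cd-monomial m) (cd-monomial (suc m)) g raise)
          (sym (expand-trim m (cd-monomial (suc m)) g top))
    where
    raise : ∀ j → j ≤ m → d * (g j * cd-monomial m j) ≡ g j * cd-monomial (suc m) j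
    raise j j≤m = trans (lift-right d (g j) (c ^ j) (d ^ (m ∸ j)))
                        (cong (λ e → g j * (c ^ j * d ^ e)) (sym (ℕP.+-∸-assoc 1 j≤m)))

  H-mul-c : ∀ m g → c * H m g ≡ H (suc m) (shift g)
  H-mul-c m g =
    trans (expand-rescale m c (cd-monomial m) (λ j → cd-monomial (suc m) (suc j)) g
             (λ j _ → lift-left c (g j) (c ^ j) (d ^ (m ∸ j))))
          (sym (expand-shift m (cd-monomial (suc m)) g))

  -- T_n is the expansion of tc n; the terms with ⌊n/2⌋ < k ≤ n vanish.
  T-expansion : ∀ n → T n b c ≡ G n (tc n)
  T-expansion n =
    trans (sum-cong (suc (n / 2)) (λ k _ → *-assoc (tc n k) (b ^ (n ∸ 2 ℕ.* k)) (c ^ k)))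
          (sym (expand-extend (bc-monomial n) (tc n) (m/n≤m n 2)
                  (λ k n/2<k → tc-vanish n k (beyond-half n k n/2<k))))

  tc-vanish-above : ∀ {n m} → n ≤ m → ∀ k → m < 2 ℕ.* k → tc n k ≡ 0ℤ
  tc-vanish-above {n} n≤m k m<2k = tc-vanish n k (ℕP.≤-<-trans n≤m m<2k)

  T-recurrence : ∀ n → + suc (suc n) * T (suc (suc n)) b c + + suc n * (b * (b * T n b c))
                       ≡ odd (suc n) * (b * T (suc n) b c) + + 4 * + suc n * (c * T n b c)
  T-recurrence n = begin
    k₂ * T (suc (suc n)) b c + k₁ * (b * (b * T n b c))
      ≡⟨ cong₂ (λ x y → k₂ * x + k₁ * (b * (b * y))) (T-expansion (suc (suc n))) (T-expansion n) ⟩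
    k₂ * G (suc (suc n)) (tc (suc (suc n))) + k₁ * (b * (b * G n (tc n)))
      ≡⟨ cong (λ x → k₂ * G (suc (suc n)) (tc (suc (suc n))) + k₁ * x) b²-lift ⟩
    k₂ * G (suc (suc n)) (tc (suc (suc n))) + k₁ * G (suc (suc n)) (tc n)
      ≡⟨ expand-lin (suc (suc n)) (bc-monomial (suc (suc n))) k₂ k₁ (tc (suc (suc n))) (tc n) ⟨
    G (suc (suc n)) (λ k → k₂ * tc (suc (suc n)) k + k₁ * tc n k)
      ≡⟨ expand-cong (suc (suc n)) (bc-monomial (suc (suc n))) (tc-recurrence n) ⟩
    G (suc (suc n)) (λ k → odd (suc n) * tc (suc n) k + + 4 * k₁ * shift (tc n) k)
      ≡⟨ expand-lin (suc (suc n)) (bc-monomial (suc (suc n))) (odd (suc n)) (+ 4 * k₁)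
                    (tc (suc n)) (shift (tc n)) ⟩
    odd (suc n) * G (suc (suc n)) (tc (suc n)) + + 4 * k₁ * G (suc (suc n)) (shift (tc n))
      ≡⟨ cong₂ (λ x y → odd (suc n) * x + + 4 * k₁ * y)
               (G-mul-b (suc n) (tc (suc n)) (tc-vanish-above ℕP.≤-refl))
               (G-mul-c n (tc n) (tc-vanish n (suc n) (n<2[1+n] n))) ⟨
    odd (suc n) * (b * G (suc n) (tc (suc n))) + + 4 * k₁ * (c * G n (tc n))
      ≡⟨ cong₂ (λ x y → odd (suc n) * (b * x) + + 4 * k₁ * (c * y))
               (T-expansion (suc n)) (T-expansion n) ⟨
    odd (suc n) * (b * T (suc n) b c) + + 4 * k₁ * (c * T n b c) ∎
    where
    k₁ k₂ : ℤ
    k₁ = + suc n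
    k₂ = + suc (suc n)
    b²-lift : b * (b * G n (tc n)) ≡ G (suc (suc n)) (tc n)
    b²-lift = trans (cong (b *_) (G-mul-b n (tc n) (tc-vanish-above ℕP.≤-refl)))
                    (G-mul-b (suc n) (tc n) (tc-vanish-above (ℕP.n≤1+n n)))

  T-recurrence′ : ∀ n → + suc (suc n) * T (suc (suc n)) b c
                        ≡ odd (suc n) * b * T (suc n) b c - + suc n * d * T n b c
  T-recurrence′ n = solveFor (+ suc n) (+ suc (suc n)) (odd (suc n)) (T n b c) (T (suc n) b c)
                      (T (suc (suc n)) b c) (T-recurrence n)
    where
    solveFor : ∀ k₁ k₂ k₃ T₀ T₁ T₂ → k₂ * T₂ + k₁ * (b * (b * T₀)) ≡ k₃ * (b * T₁) + + 4 * k₁ * (c * T₀) →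
               k₂ * T₂ ≡ k₃ * b * T₁ - k₁ * d * T₀
    solveFor k₁ k₂ k₃ T₀ T₁ T₂ h = begin
      k₂ * T₂                                                ≡⟨ solve (k₁ ∷ k₂ ∷ b ∷ T₀ ∷ T₂ ∷ []) ⟩
      k₂ * T₂ + k₁ * (b * (b * T₀)) - k₁ * (b * (b * T₀))     ≡⟨ cong (_- k₁ * (b * (b * T₀))) h ⟩
      k₃ * (b * T₁) + + 4 * k₁ * (c * T₀) - k₁ * (b * (b * T₀)) ≡⟨ solve (k₁ ∷ k₃ ∷ b ∷ c ∷ T₀ ∷ T₁ ∷ []) ⟩
      k₃ * b * T₁ - k₁ * (b * b - + 4 * c) * T₀             ∎

  -- Q_n (which turns out to be T_n²), the auxiliary sum R_n, and the sum S_n of the theorem.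
  Q R : ℕ → ℤ
  Q n = H n (qc n)
  R n = H n (rc n)

  S : ℕ → ℤ
  S n = sumBelow n (λ j → (+ (n ∸ j)) * binomℤ (n ℕ.+ j) (2 ℕ.* j)
          * (binomℤ (2 ℕ.* j) j ^ 2) * (c ^ j) * ((b * b - (+ 4) * c) ^ (n ∸ 1 ∸ j)))

  S-expansion : ∀ m → S (suc m) ≡ H m (sc (suc m))
  S-expansion m = sum-cong (suc m) λ j j<1+m →
    trans (cong (λ x → x * X j * Y j * c ^ j * d ^ (m ∸ j)) (∸-cast (ℕP.<⇒≤ j<1+m)))
          (reassociate (+ suc m - + j) (X j) (Y j) (c ^ j) (d ^ (m ∸ j)))
    where
    X Y : ℕ → ℤ
    X j = binomℤ (suc m ℕ.+ j) (2 ℕ.* j)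
    Y j = binomℤ (2 ℕ.* j) j ^ 2
    reassociate : ∀ s x y u v → s * x * y * u * v ≡ s * (x * y) * (u * v)
    reassociate = solve-∀

  dS-expansion : ∀ m → d * S m ≡ H m (sc m)
  dS-expansion zero    = *-zeroʳ d
  dS-expansion (suc m) = trans (cong (d *_) (S-expansion m)) (H-mul-d m (sc (suc m)) top)
    where
    top : sc (suc m) (suc m) ≡ 0ℤ
    top = cong (_* qc (suc m) (suc m)) (+-inverseʳ (+ suc m))

  S-recurrence : ∀ n → S (suc n) ≡ R n + d * S n
  S-recurrence n = begin
    S (suc n)                      ≡⟨ S-expansion n ⟩
    H n (sc (suc n))               ≡⟨ expand-cong n (cd-monomial n) (qc-upper n) ⟩
    H n (λ j → rc n j + sc n j)    ≡⟨ expand-+ n (cd-monomial n) (rc n) (sc n) ⟩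
    R n + H n (sc n)               ≡⟨ cong (λ x → R n + x) (dS-expansion n) ⟨
    R n + d * S n                  ∎

  Q-via-R : ∀ n → odd n * Q n ≡ R n + + 2 * (d * S n)
  Q-via-R n = begin
    odd n * Q n                              ≡⟨ expand-scale n (cd-monomial n) (odd n) (qc n) ⟨
    H n (λ j → odd n * qc n j)              ≡⟨ expand-cong n (cd-monomial n) (λ j → split (+ n) (+ j) (qc n j)) ⟩
    H n (λ j → rc n j + + 2 * sc n j)       ≡⟨ expand-+ n (cd-monomial n) (rc n) (λ j → + 2 * sc n j) ⟩
    R n + H n (λ j → + 2 * sc n j)          ≡⟨ cong (λ x → R n + x) (expand-scale n (cd-monomial n) (+ 2) (sc n)) ⟩
    R n + + 2 * H n (sc n)                  ≡⟨ cong (λ x → R n + + 2 * x) (dS-expansion n) ⟨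
    R n + + 2 * (d * S n)                   ∎
    where
    split : ∀ ν ι q → (+ 2 * ν + 1ℤ) * q ≡ (+ 2 * ι + 1ℤ) * q + + 2 * ((ν - ι) * q)
    split = solve-∀

  Q-recurrence : ∀ n → + suc (suc n) * + suc (suc n) * Q (suc (suc n))
                       ≡ odd (suc n) * b * b * R (suc n) + + suc n * + suc n * d * d * Q n
  Q-recurrence n = begin
    k₂ * k₂ * Q (suc (suc n))
      ≡⟨ expand-scale (suc (suc n)) w (k₂ * k₂) (qc (suc (suc n))) ⟨
    H (suc (suc n)) (λ j → k₂ * k₂ * qc (suc (suc n)) j)
      ≡⟨ expand-cong (suc (suc n)) w (qc-recurrence n) ⟩
    H (suc (suc n)) (λ j → k₃ * rc (suc n) j + + 4 * k₃ * shift (rc (suc n)) j + k₁ * k₁ * qc n j)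
      ≡⟨ expand-+ (suc (suc n)) w (λ j → k₃ * rc (suc n) j + + 4 * k₃ * shift (rc (suc n)) j)
                  (λ j → k₁ * k₁ * qc n j) ⟩
    H (suc (suc n)) (λ j → k₃ * rc (suc n) j + + 4 * k₃ * shift (rc (suc n)) j)
      + H (suc (suc n)) (λ j → k₁ * k₁ * qc n j)
      ≡⟨ cong₂ _+_ (expand-lin (suc (suc n)) w k₃ (+ 4 * k₃) (rc (suc n)) (shift (rc (suc n))))
                   (expand-scale (suc (suc n)) w (k₁ * k₁) (qc n)) ⟩
    k₃ * H (suc (suc n)) (rc (suc n)) + + 4 * k₃ * H (suc (suc n)) (shift (rc (suc n)))
      + k₁ * k₁ * H (suc (suc n)) (qc n)
      ≡⟨ cong₂ (λ x y → k₃ * x + + 4 * k₃ * y + k₁ * k₁ * H (suc (suc n)) (qc n))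
               (H-mul-d (suc n) (rc (suc n)) rc-top) (H-mul-c (suc n) (rc (suc n))) ⟨
    k₃ * (d * R (suc n)) + + 4 * k₃ * (c * R (suc n)) + k₁ * k₁ * H (suc (suc n)) (qc n)
      ≡⟨ cong (λ x → k₃ * (d * R (suc n)) + + 4 * k₃ * (c * R (suc n)) + k₁ * k₁ * x) d²-lift ⟨
    k₃ * (d * R (suc n)) + + 4 * k₃ * (c * R (suc n)) + k₁ * k₁ * (d * (d * Q n))
      ≡⟨ eliminate-c b c k₃ (k₁ * k₁) (R (suc n)) (Q n) ⟩
    k₃ * b * b * R (suc n) + k₁ * k₁ * d * d * Q n ∎
    where
    k₁ k₂ k₃ : ℤ
    k₁ = + suc n
    k₂ = + suc (suc n)
    k₃ = odd (suc n)
    w : ℕ → ℤ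
    w = cd-monomial (suc (suc n))
    rc-top : rc (suc n) (suc (suc n)) ≡ 0ℤ
    rc-top = trans (cong (odd (suc (suc n)) *_) (qc-vanish (suc n) (suc (suc n)) (ℕP.n<1+n (suc n))))
                   (*-zeroʳ (odd (suc (suc n))))
    d²-lift : d * (d * Q n) ≡ H (suc (suc n)) (qc n)
    d²-lift = trans (cong (d *_) (H-mul-d n (qc n) (qc-vanish n (suc n) (ℕP.n<1+n n))))
                    (H-mul-d (suc n) (qc n) (qc-vanish n (suc (suc n)) (ℕP.m<n⇒m<1+n (ℕP.n<1+n n))))
    eliminate-c : ∀ b c k s r q →
      k * ((b * b - + 4 * c) * r) + + 4 * k * (c * r) + s * ((b * b - + 4 * c) * ((b * b - + 4 * c) * q))
      ≡ k * b * b * r + s * (b * b - + 4 * c) * (b * b - + 4 * c) * q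
    eliminate-c = solve-∀

  T-one : T 1 b c ≡ b
  T-one = normalForm b
    where
    normalForm : ∀ x → + 0 + 1ℤ * 1ℤ * (x * 1ℤ) * 1ℤ ≡ x
    normalForm = solve-∀

  Q-one : Q 1 ≡ b * b
  Q-one = normalForm b c
    where
    normalForm : ∀ x y → + 0 + 1ℤ * (1ℤ * ((x * x - + 4 * y) * 1ℤ)) + + 4 * (y * 1ℤ * 1ℤ) ≡ x * x
    normalForm = solve-∀

  Invariant : ℕ → Set
  Invariant n = (T n b c * T n b c ≡ Q n) × (T (suc n) b c * T (suc n) b c ≡ Q (suc n))
                × (+ suc n * T (suc n) b c * T n b c ≡ b * S (suc n))

  invariant : ∀ n → Invariant n
  invariant zero    = refl , trans (cong₂ _*_ T-one T-one) (sym Q-one)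
                           , trans (cong (λ x → 1ℤ * x * 1ℤ) T-one) (unit b)
    where
    unit : ∀ x → 1ℤ * x * 1ℤ ≡ x * 1ℤ
    unit = solve-∀
  invariant (suc n) with invariant n
  ... | square₀ , square₁ , product₁ =
    square₁ , *-cancelˡ-≡ (k₂ * k₂) (T (suc (suc n)) b c * T (suc (suc n)) b c) (Q (suc (suc n))) square₂
            , product₂
    where
    k₂ : ℤ
    k₂ = + suc (suc n)
    open InductionStep b d (+ suc n) k₂ (odd (suc n)) (T n b c) (T (suc n) b c) (T (suc (suc n)) b c)
                       (Q n) (Q (suc n)) (Q (suc (suc n))) (R (suc n)) (S (suc n)) (S (suc (suc n)))
                       (T-recurrence′ n) square₀ square₁ product₁ (Q-via-R (suc n)) (S-recurrence (suc n))
                       (Q-recurrence n)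

lemma4p1 : (b c : ℤ) → (n : ℕ) → ℕ.NonZero n →
    (+ n) * T n b c * T (n ∸ 1) b c
      ≡ b * sumBelow n (λ j → (+ (n ∸ j)) * binomℤ (n ℕ.+ j) (2 ℕ.* j)
            * (binomℤ (2 ℕ.* j) j ^ 2) * (c ^ j)
            * ((b * b - (+ 4) * c) ^ (n ∸ 1 ∸ j)))
lemma4p1 b c (suc m) _ = proj₂ (proj₂ (invariant b c m))
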